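{- For every formula $\phi$ of the language $\phi ::= p \mid \bot \mid \phi\to\phi \mid K_a\phi$ ($a\in A$): if $\phi$ is valid in the base-extension semantics for multi-agent $S5$, i.e. $\Vdash_{\mathscr{B},\mathfrak{R}_A}\phi$ for every base $\mathscr{B}$ and every family $\mathfrak{R}_A=(\mathfrak{R}_a)_{a\in A}$ of $S5$-modal relations, then $\phi$ is a theorem of multi-agent modal logic $S5$ (derivable in the Hilbert system described in the context).
   Context: Fix a countably infinite set of atomic formulae and a nonempty set $A$ of agents. Formulae: $\phi ::= p \mid \bot \mid \phi\to\phi \mid K_a\phi$ with $p$ atomic and $a\in A$; $\neg\phi$ abbreviates $\phi\to\bot$. Hilbert system for multi-agent $S5$: axioms, for all formulae $\phi,\psi,\chi$ and all $a\in A$: (1) $\phi\to(\psi\to\phi)$; (2) $(\phi\to(\psi\to\chi))\to((\phi\to\psi)\to(\phi\to\chi))$; (3) $(\neg\phi\to\neg\psi)\to(\psi\to\phi)$; (K) $K_a(\phi\to\psi)\to(K_a\phi\to K_a\psi)$; (T) $K_a\phi\to\phi$; (4) $K_a\phi\to K_aK_a\phi$; (5) $\neg K_a\phi\to K_a\neg K_a\phi$; rules (MP) from $\phi$ and $\phi\to\psi$ infer $\psi$; (NEC) from $\phi$ infer $K_a\phi$. A theorem is a formula derivable in this system. A base rule is written $p_1,\dots,p_n\Rightarrow p$, where $\{p_1,\dots,p_n\}$ is a finite (possibly empty) set of atoms and $p$ is an atom. A base is a countable set of base rules; $\Omega$ is the set of all bases. $\overline{\mathscr{B}}$ is the smallest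 set of atoms closed under the rules of $\mathscr{B}$. A base $\mathscr{B}$ is inconsistent iff every atom lies in $\overline{\mathscr{B}}$, and consistent otherwise. An $S5$-modal relation is a binary relation $\mathfrak{R}$ on $\Omega$ that is reflexive, transitive and Euclidean (if $\mathfrak{R}\mathscr{B}\mathscr{C}$ and $\mathfrak{R}\mathscr{B}\mathscr{D}$ then $\mathfrak{R}\mathscr{C}\mathscr{D}$) and satisfies, for all bases $\mathscr{B}$: (a) if $\mathscr{B}$ is inconsistent, there is an inconsistent $\mathscr{C}$ with $\mathfrak{R}\mathscr{B}\mathscr{C}$, and every $\mathscr{D}$ with $\mathfrak{R}\mathscr{B}\mathscr{D}$ is inconsistent; (b) if $\mathscr{B}$ is consistent, every $\mathscr{C}$ with $\mathfrak{R}\mathscr{B}\mathscr{C}$ is consistent; (c) for all $\mathscr{C}$, if $\mathfrak{R}\mathscr{B}\mathscr{C}$ then for every consistent $\mathscr{D}\supseteq\mathscr{B}$ there is $\mathscr{E}\supseteq\mathscr{C}$ with $\mathfrak{R}\mathscr{D}\mathscr{E}$; (d) for all consistent $\mathscr{C}$, if $\mathfrak{R}\mathscr{B}\mathscr{C}$ then for every $\mathscr{D}\subseteq\mathscr{B}$ there is $\mathscr{E}\subseteq\mathscr{C}$ with $\mathfrak{R}\mathscr{D}\mathscr{E}$. For a family $\mathfrak{R}_A=(\mathfrak{R}_a)_{a\in A}$ of $S5$-modal relations, validity at a base is defined inductively: $\Vdash_{\mathscr{B},\mathfrak{R}_A}p$ iff $p\in\overline{\mathscr{B}}$; $\Vdash_{\mathscr{B},\mathfrak{R}_A}\phi\to\psi$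 iff $\phi\Vdash_{\mathscr{B},\mathfrak{R}_A}\psi$; $\Vdash_{\mathscr{B},\mathfrak{R}_A}\bot$ iff $\Vdash_{\mathscr{B},\mathfrak{R}_A}p$ for every atom $p$; $\Vdash_{\mathscr{B},\mathfrak{R}_A}K_a\phi$ iff $\Vdash_{\mathscr{C},\mathfrak{R}_A}\phi$ for all $\mathscr{C}$ with $\mathfrak{R}_a\mathscr{B}\mathscr{C}$; and for a nonempty set $\Gamma$ of formulae, $\Gamma\Vdash_{\mathscr{B},\mathfrak{R}_A}\phi$ iff for every $\mathscr{C}\supseteq\mathscr{B}$, if $\Vdash_{\mathscr{C},\mathfrak{R}_A}\psi$ for all $\psi\in\Gamma$ then $\Vdash_{\mathscr{C},\mathfrak{R}_A}\phi$. -}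

module Defs where

open import Data.Nat using (ℕ)
import Level
open import Level using (Lift)
open import Data.List using (List)
open import Data.List.Relation.Unary.All using (All)
open import Data.Product using (Σ; _×_; _,_)
open import Relation.Nullary using (¬_)

data Formula (A : Set) : Set where
  atom : ℕ → Formula A
  ⊥'   : Formula A
  _⇒_  : Formula A → Formula A → Formula A
  K    : A → Formula A → Formula A

infixr 5 _⇒_

¬' : {A : Set} → Formula A → Formula A
¬' φ = φ ⇒ ⊥'

data Thm {A : Set} : Formula A → Set where
  ax1  : ∀ φ ψ → Thm (φ ⇒ (ψ ⇒ φ))
  ax2  : ∀ φ ψ χ → Thm ((φ ⇒ (ψ ⇒ χ)) ⇒ ((φ ⇒ ψ) ⇒ (φ ⇒ χ)))
  ax3  : ∀ φ ψ → Thm ((¬' φ ⇒ ¬' ψ) ⇒ (ψ ⇒ φ))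
  axK  : ∀ a φ ψ → Thm (K a (φ ⇒ ψ) ⇒ (K a φ ⇒ K a ψ))
  axT  : ∀ a φ → Thm (K a φ ⇒ φ)
  ax4  : ∀ a φ → Thm (K a φ ⇒ K a (K a φ))
  ax5  : ∀ a φ → Thm (¬' (K a φ) ⇒ K a (¬' (K a φ)))
  mp   : ∀ {φ ψ} → Thm φ → Thm (φ ⇒ ψ) → Thm ψ
  nec  : ∀ a {φ} → Thm φ → Thm (K a φ)

-- A base rule p₁,…,pₙ ⇒ p : finite list of premise atoms and a conclusion.
Rule : Set
Rule = Σ (List ℕ) (λ _ → ℕ)

-- A base is a set of base rules (countable automatically, as Rule is countable).
Base : Set₁
Base = Rule → Set

_⊆B_ : Base → Base → Set
B ⊆B C = ∀ r → B r → C r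

data _⊢_ (B : Base) : ℕ → Set where
  use : ∀ {ps p} → B (ps , p) → All (B ⊢_) ps → B ⊢ p

Inconsistent : Base → Set
Inconsistent B = ∀ p → B ⊢ p

Consistent : Base → Set
Consistent B = ¬ Inconsistent B

Rel : Set₁
Rel = Base → Base → Set

record IsS5Modal (R : Rel) : Set₁ where
  field
    refl      : ∀ B → R B B
    trans     : ∀ B C D → R B C → R C D → R B D
    euclidean : ∀ B C D → R B C → R B D → R C D
    condA     : ∀ B → Inconsistent B →
                  Σ Base (λ C → R B C × Inconsistent C)
                × (∀ D → R B D → Inconsistent D)
    condB     : ∀ B → Consistent B → ∀ C → R B C → Consistent C
    condC     : ∀ B C → R B C → ∀ D → Consistent D → B ⊆B D →
                  Σ Base (λ E → C ⊆B E × R D E)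
    condD     : ∀ B C → Consistent C → R B C → ∀ D → D ⊆B B →
                  Σ Base (λ E → E ⊆B C × R D E)

⊩ : {A : Set} → (A → Rel) → Base → Formula A → Set₁
-- (for a singleton Γ = {φ}, φ ⊩_B ψ quantifies over all extensions C ⊇ B)
⊩ R B (atom p) = Lift (Level.suc Level.zero) (B ⊢ p)
⊩ R B ⊥' = Lift (Level.suc Level.zero) (∀ p → B ⊢ p)
⊩ R B (φ ⇒ ψ) = ∀ C → B ⊆B C → ⊩ R C φ → ⊩ R C ψ
⊩ R B (K a φ) = ∀ C → R a B C → ⊩ R C φ

-- The argument is constructive, so it cannot split on whether a formula is derivable.  Instead it
-- runs relative to the answer type T = Thm φ: a proposition X is "decided" as X ⊎ (X → T), and a
-- world only has to be consistent in the sense that its inconsistency would yield T.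
--
-- Treat the atoms and the K-subformula occurrences of φ as propositional letters.  The worlds are
-- the valuations of these letters whose literals are consistent, and world j is a-accessible from i
-- when their K_a-letters agree.  World i is represented by a base Canonical i which, through atoms
-- indexed by maps of worlds, records every world as seen from i; permuting the worlds renames atoms,
-- and "related by a permutation respecting a-accessibility" is an S5-modal relation.  A truth lemma
-- shows that at every extension of Canonical i an occurrence is forced iff it is true at i, unless
-- the extension is inconsistent.  The hard case is K_a ψ false at i: either some a-accessible world
-- falsifies ψ, and the transposition exchanging it with i gives a successor base refuting ψ, or ψ
-- follows from the a-introspective literals of i by case analysis on the remaining letters, so that
-- K_a ψ follows by necessitation and world i is inconsistent.  Validity at every Canonical j thus
-- makes φ true in every world, and case analysis on all letters turns this into a derivation of φ.

module Submission where

open import Defs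
open import Level using (lift)
open import Data.Bool using (Bool; true; false; not; _∨_)
import Data.Bool.Properties as Bool
open import Data.Empty using (⊥; ⊥-elim)
import Data.Fin as Fin
open import Data.Fin using (Fin; toℕ; fromℕ<; combine; funToFin; finToFun)
open import Data.Fin.Properties
  using (toℕ<n; toℕ-fromℕ<; toℕ-injective; combine-injective; finToFun-funToFin; all?; any?)
  renaming (_≟_ to _≟ᶠ_)
import Data.Fin.Permutation as Perm
open import Data.Fin.Permutation using (Permutation′; _⟨$⟩ʳ_; _⟨$⟩ˡ_; inverseˡ; inverseʳ)
open import Data.List using (List; []; _∷_; [_]; _++_; map; cartesianProduct; length; lookup)
open import Data.List.Properties using (++-identityʳ; map-∘; map-cong; map-id)
open import Data.List.Membership.Propositional using (_∈_)
open import Data.List.Membership.Propositional.Properties using (∈-cartesianProduct⁺)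
open import Data.List.Relation.Binary.Subset.Propositional using (_⊆_)
open import Data.List.Relation.Binary.Subset.Propositional.Properties
  using (⊆-reflexive-↭; xs⊆xs++ys; xs⊆ys++xs; ++⁺; ∷⁺ʳ)
open import Data.List.Relation.Binary.Permutation.Propositional using (_↭_; ↭-sym; ↭-trans)
open import Data.List.Relation.Binary.Permutation.Propositional.Properties
  using (shift; shifts; ++-assoc)
open import Data.List.Relation.Unary.All using (All; []; _∷_)
import Data.List.Relation.Unary.All.Properties as All
open import Data.List.Relation.Unary.Any using (Any; here; there; index)
open import Data.List.Relation.Unary.Any.Properties using (lookup-index)
open import Data.Nat using (ℕ; zero; suc; _+_; _*_; _^_; _<_; _≤_; _⊔_; s≤s)
open import Data.Nat.Properties
  using (≤-refl; ≤-trans; m≤m⊔n; m≤n⊔m; m≤m+n; <-≤-trans; +-monoʳ-<; +-cancelˡ-≡; <⇒≢; _≟_)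
open import Data.Product using (Σ; Σ-syntax; ∃; ∃₂; _×_; _,_; proj₁; proj₂)
open import Data.Sum using (_⊎_; inj₁; inj₂)
import Data.Sum as Sum
open import Data.Unit using (⊤; tt)
open import Function using (_∘_; _$_; id)
open import Relation.Binary using (IsEquivalence)
open import Relation.Binary.PropositionalEquality
  using (_≡_; _≗_; refl; sym; trans; cong; cong₂; subst)
open import Relation.Nullary using (Dec; yes; no; ¬_)
open import Relation.Nullary.Decidable using (_×-dec_)

variable
  T : Set
  m n : ℕ
  B C D : Base

_⇒ᵇ_ : Bool → Bool → Bool
x ⇒ᵇ y = not x ∨ y

⇒ᵇ-true : ∀ x {y} → x ⇒ᵇ y ≡ true → x ≡ false ⊎ y ≡ true
⇒ᵇ-true false _  = inj₁ refl
⇒ᵇ-true true  eq = inj₂ eq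

⇒ᵇ-false : ∀ x {y} → x ⇒ᵇ y ≡ false → x ≡ true × y ≡ false
⇒ᵇ-false true eq = refl , eq

module _ {B C : Base} (f : ℕ → ℕ) (B→C : ∀ {ps q} → B (ps , q) → C (map f ps , f q)) where

  ⊢-map : B ⊢ n → C ⊢ f n
  ⊢-mapAll : ∀ {ns} → All (B ⊢_) ns → All (C ⊢_) (map f ns)

  ⊢-map (use r ds) = use (B→C r) (⊢-mapAll ds)

  ⊢-mapAll []       = []
  ⊢-mapAll (d ∷ ds) = ⊢-map d ∷ ⊢-mapAll ds

inconsistent-mono : B ⊆B C → Inconsistent B → Inconsistent C
inconsistent-mono {C = C} B⊆C inc n =
  ⊢-map id (λ {ps} r → subst (λ ps → C (ps , _)) (sym (map-id ps)) (B⊆C _ r)) (inc n)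

inconsistent⇒⊩ : {A : Set} {R : A → Rel} {φ : Formula A} →
                 (∀ a → IsS5Modal (R a)) → Inconsistent B → ⊩ R B φ
inconsistent⇒⊩ {φ = atom p} S5 inc = lift (inc p)
inconsistent⇒⊩ {φ = ⊥'}     S5 inc = lift inc
inconsistent⇒⊩ {φ = φ ⇒ ψ}  S5 inc = λ C B⊆C _ → inconsistent⇒⊩ S5 (inconsistent-mono B⊆C inc)
inconsistent⇒⊩ {B = B} {φ = K a φ} S5 inc =
  λ C BRC → inconsistent⇒⊩ S5 (proj₂ (IsS5Modal.condA (S5 a) B inc) C BRC)

_≐B_ : Base → Base → Set
B ≐B C = B ⊆B C × C ⊆B B

⊆B-trans : B ⊆B C → C ⊆B D → B ⊆B D
⊆B-trans B⊆C C⊆D r = C⊆D r ∘ B⊆C r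

≐B-refl : B ≐B B
≐B-refl = (λ _ → id) , (λ _ → id)

≐B-sym : B ≐B C → C ≐B B
≐B-sym (B⊆C , C⊆B) = C⊆B , B⊆C

≐B-trans : B ≐B C → C ≐B D → B ≐B D
≐B-trans (B⊆C , C⊆B) (C⊆D , D⊆C) = ⊆B-trans B⊆C C⊆D , ⊆B-trans D⊆C C⊆B

≐B-precompose : {f g : Rule → Rule} → (∀ r → f r ≡ g r) → (B ∘ f) ≐B (B ∘ g)
≐B-precompose {B = B} f≗g = (λ r → subst B (f≗g r)) , (λ r → subst B (sym (f≗g r)))

Cont : Set → Set → Set
Cont T X = (X → T) → T

Decᵀ : Set → Set → Set
Decᵀ T X = X ⊎ (X → T)

decideᵀ : {X : Set} → Cont T (Decᵀ T X)
decideᵀ k = k (inj₂ (k ∘ inj₁))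

allᶜ : {X : Set} {P : X → Set} → (∀ x → Cont T (P x)) → ∀ xs → Cont T (All P xs)
allᶜ f []       k = k []
allᶜ f (x ∷ xs) k = f x λ px → allᶜ f xs λ pxs → k (px ∷ pxs)

module _ {A : Set} where

  variable
    a b : A
    φ ψ χ θ : Formula A
    Γ Δ : List (Formula A)
    P F : A → Set

  infix 3 _⊢ᴴ_

  data _⊢ᴴ_ (Γ : List (Formula A)) : Formula A → Set where
    hyp    : φ ∈ Γ → Γ ⊢ᴴ φ
    thm    : Thm φ → Γ ⊢ᴴ φ
    ⇒-elim : Γ ⊢ᴴ φ ⇒ ψ → Γ ⊢ᴴ φ → Γ ⊢ᴴ ψ

  weaken : Γ ⊆ Δ → Γ ⊢ᴴ φ → Δ ⊢ᴴ φ
  weaken Γ⊆Δ (hyp φ∈Γ)    = hyp (Γ⊆Δ φ∈Γ)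
  weaken Γ⊆Δ (thm t)      = thm t
  weaken Γ⊆Δ (⇒-elim d e) = ⇒-elim (weaken Γ⊆Δ d) (weaken Γ⊆Δ e)

  wk : Γ ⊢ᴴ φ → ψ ∷ Γ ⊢ᴴ φ
  wk = weaken there

  reorder : Γ ↭ Δ → Γ ⊢ᴴ φ → Δ ⊢ᴴ φ
  reorder = weaken ∘ ⊆-reflexive-↭

  hyp₀ : φ ∷ Γ ⊢ᴴ φ
  hyp₀ = hyp (here refl)

  ⇒-refl : Thm (φ ⇒ φ)
  ⇒-refl {φ = φ} = mp (ax1 φ φ) (mp (ax1 φ (φ ⇒ φ)) (ax2 φ (φ ⇒ φ) φ))

  ⇒-intro : φ ∷ Γ ⊢ᴴ ψ → Γ ⊢ᴴ φ ⇒ ψ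
  ⇒-intro (hyp (here refl)) = thm ⇒-refl
  ⇒-intro (hyp (there ψ∈Γ)) = ⇒-elim (thm (ax1 _ _)) (hyp ψ∈Γ)
  ⇒-intro (thm t)           = ⇒-elim (thm (ax1 _ _)) (thm t)
  ⇒-intro (⇒-elim d e)      = ⇒-elim (⇒-elim (thm (ax2 _ _ _)) (⇒-intro d)) (⇒-intro e)

  []⊢ᴴ⇒Thm : [] ⊢ᴴ φ → Thm φ
  []⊢ᴴ⇒Thm (thm t)      = t
  []⊢ᴴ⇒Thm (⇒-elim d e) = mp ([]⊢ᴴ⇒Thm e) ([]⊢ᴴ⇒Thm d)

  ⊥-elimᴴ : Γ ⊢ᴴ ⊥' → Γ ⊢ᴴ φ
  ⊥-elimᴴ {φ = φ} = ⇒-elim (thm (mp (mp ⇒-refl (ax1 (⊥' ⇒ ⊥') (¬' φ))) (ax3 φ ⊥')))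

  ¬¬-elim : Γ ⊢ᴴ ¬' (¬' φ) → Γ ⊢ᴴ φ
  ¬¬-elim {φ = φ} =
    ⇒-elim (⇒-elim (thm (ax3 φ (¬' (¬' φ)))) (⇒-intro (⇒-intro (⇒-elim hyp₀ (wk hyp₀)))))

  by-cases : φ ∷ Γ ⊢ᴴ χ → ¬' φ ∷ Γ ⊢ᴴ χ → Γ ⊢ᴴ χ
  by-cases {φ = φ} {Γ = Γ} {χ = χ} d e =
    ¬¬-elim (⇒-intro (⇒-elim hyp₀ (⇒-elim (wk (⇒-intro e)) ¬φ)))
    where
    ¬φ : ¬' χ ∷ Γ ⊢ᴴ ¬' φ
    ¬φ = ⇒-intro (⇒-elim (wk hyp₀) (⇒-elim (wk (wk (⇒-intro d))) hyp₀))

  Introspective : A → Formula A → Set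
  Introspective a δ = Thm (δ ⇒ K a δ)

  K-intro : All (Introspective a) Δ → Δ ⊢ᴴ ψ → Δ ⊢ᴴ K a ψ
  K-intro {a = a} []       d = thm (nec a ([]⊢ᴴ⇒Thm d))
  K-intro {a = a} (t ∷ ts) d =
    ⇒-elim (wk (⇒-elim (thm (axK a _ _)) (K-intro ts (⇒-intro d)))) (⇒-elim (thm t) hyp₀)

  lit : Formula A → Bool → Formula A
  lit ψ true  = ψ
  lit ψ false = ¬' ψ

  lit-⇒ : ∀ x y → Γ ⊢ᴴ lit ψ x → Γ ⊢ᴴ lit χ y → Γ ⊢ᴴ lit (ψ ⇒ χ) (x ⇒ᵇ y)
  lit-⇒ false _     ¬ψ _  = ⇒-intro (⊥-elimᴴ (⇒-elim (wk ¬ψ) hyp₀))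
  lit-⇒ true  true  _  χ  = ⇒-elim (thm (ax1 _ _)) χ
  lit-⇒ true  false ψ  ¬χ = ⇒-intro (⇒-elim (wk ¬χ) (⇒-elim hyp₀ (wk ψ)))

  -- A letter is an atom or a formula K a ψ.  Val ψ assigns a truth value to every letter occurrence
  -- of ψ separately; assignments that give two occurrences of one letter different values are
  -- Contradictory and never become worlds.
  Val : Formula A → Set
  Val (atom _) = Bool
  Val ⊥'       = ⊤
  Val (ψ ⇒ χ)  = Val ψ × Val χ
  Val (K _ ψ)  = Bool × Val ψ

  eval : (ψ : Formula A) → Val ψ → Bool
  eval (atom _) x       = x
  eval ⊥'       _       = false
  eval (ψ ⇒ χ)  (u , w) = eval ψ u ⇒ᵇ eval χ w
  eval (K _ _)  (x , _) = x

  literals : (ψ : Formula A) → Val ψ → List (Formula A)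
  literals (atom p) x       = [ lit (atom p) x ]
  literals ⊥'       _       = []
  literals (ψ ⇒ χ)  (u , w) = literals ψ u ++ literals χ w
  literals (K a ψ)  (x , u) = lit (K a ψ) x ∷ literals ψ u

  Contradictory : (ψ : Formula A) → Val ψ → Set
  Contradictory ψ u = literals ψ u ⊢ᴴ ⊥'

  kalmar : (ψ : Formula A) (u : Val ψ) → literals ψ u ⊢ᴴ lit ψ (eval ψ u)
  kalmar (atom p) x       = hyp₀
  kalmar ⊥'       _       = thm ⇒-refl
  kalmar (ψ ⇒ χ)  (u , w) = lit-⇒ (eval ψ u) (eval χ w)
    (weaken (xs⊆xs++ys _ _) (kalmar ψ u)) (weaken (xs⊆ys++xs _ _) (kalmar χ w))
  kalmar (K a ψ)  (x , u) = hyp₀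

  kalmar-true : (ψ : Formula A) (u : Val ψ) → eval ψ u ≡ true → literals ψ u ⊢ᴴ ψ
  kalmar-true ψ u eq = subst (λ x → literals ψ u ⊢ᴴ lit ψ x) eq (kalmar ψ u)

  kalmar-false : (ψ : Formula A) (u : Val ψ) → eval ψ u ≡ false → literals ψ u ⊢ᴴ ¬' ψ
  kalmar-false ψ u eq = subst (λ x → literals ψ u ⊢ᴴ lit ψ x) eq (kalmar ψ u)

  bools : List Bool
  bools = true ∷ false ∷ []

  ∈-bools : ∀ x → x ∈ bools
  ∈-bools true  = here refl
  ∈-bools false = there (here refl)

  valuations : (ψ : Formula A) → List (Val ψ)
  valuations (atom _) = bools
  valuations ⊥'       = [ tt ]
  valuations (ψ ⇒ χ)  = cartesianProduct (valuations ψ) (valuations χ)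
  valuations (K _ ψ)  = cartesianProduct bools (valuations ψ)

  ∈-valuations : (ψ : Formula A) (u : Val ψ) → u ∈ valuations ψ
  ∈-valuations (atom _) x       = ∈-bools x
  ∈-valuations ⊥'       tt      = here refl
  ∈-valuations (ψ ⇒ χ)  (u , w) = ∈-cartesianProduct⁺ (∈-valuations ψ u) (∈-valuations χ w)
  ∈-valuations (K _ ψ)  (x , u) = ∈-cartesianProduct⁺ (∈-bools x) (∈-valuations ψ u)

  allFalse : (ψ : Formula A) → Val ψ
  allFalse (atom _) = false
  allFalse ⊥'       = tt
  allFalse (ψ ⇒ χ)  = allFalse ψ , allFalse χ
  allFalse (K _ ψ)  = false , allFalse ψ

  data Sub (φ : Formula A) : Formula A → Set where
    root  : Sub φ φ
    left  : Sub φ (ψ ⇒ χ) → Sub φ ψ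
    right : Sub φ (ψ ⇒ χ) → Sub φ χ
    under : Sub φ (K a ψ) → Sub φ ψ

  restrict : Sub φ ψ → Val φ → Val ψ
  restrict root      u = u
  restrict (left c)  u = proj₁ (restrict c u)
  restrict (right c) u = proj₂ (restrict c u)
  restrict (under c) u = proj₂ (restrict c u)

  literals-restrict : (c : Sub φ ψ) (u : Val φ) → literals ψ (restrict c u) ⊆ literals φ u
  literals-restrict root      u = id
  literals-restrict (left c)  u = literals-restrict c u ∘ xs⊆xs++ys _ _
  literals-restrict (right c) u = literals-restrict c u ∘ xs⊆ys++xs _ _
  literals-restrict (under c) u = literals-restrict c u ∘ there

  maxAtom : Formula A → ℕ
  maxAtom (atom p) = p
  maxAtom ⊥'       = 0
  maxAtom (ψ ⇒ χ)  = maxAtom ψ ⊔ maxAtom χ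
  maxAtom (K _ ψ)  = maxAtom ψ

  maxAtom-sub : Sub φ ψ → maxAtom ψ ≤ maxAtom φ
  maxAtom-sub root              = ≤-refl
  maxAtom-sub (left  {ψ} {χ} c) = ≤-trans (m≤m⊔n (maxAtom ψ) (maxAtom χ)) (maxAtom-sub c)
  maxAtom-sub (right {ψ} {χ} c) = ≤-trans (m≤n⊔m (maxAtom ψ) (maxAtom χ)) (maxAtom-sub c)
  maxAtom-sub (under c)         = maxAtom-sub c

  data Each (P : A → Set) : Formula A → Set where
    atom : ∀ {p} → Each P (atom p)
    ⊥'   : Each P ⊥'
    _⇒_  : Each P ψ → Each P χ → Each P (ψ ⇒ χ)
    K    : P a → Each P ψ → Each P (K a ψ)

  Each-head : Each P (K a ψ) → P a
  Each-head (K x _) = x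

  restrictEach : Sub φ ψ → Each P φ → Each P ψ
  restrictEach root      e = e
  restrictEach (left c)  e with restrictEach c e
  ... | e₁ ⇒ _ = e₁
  restrictEach (right c) e with restrictEach c e
  ... | _ ⇒ e₂ = e₂
  restrictEach (under c) e with restrictEach c e
  ... | K _ e₁ = e₁

  eachᶜ : (∀ a → Cont T (P a)) → (ψ : Formula A) → Cont T (Each P ψ)
  eachᶜ f (atom _) k = k atom
  eachᶜ f ⊥'       k = k ⊥'
  eachᶜ f (ψ ⇒ χ)  k = eachᶜ f ψ λ e₁ → eachᶜ f χ λ e₂ → k (e₁ ⇒ e₂)
  eachᶜ f (K a ψ)  k = f a λ x → eachᶜ f ψ λ e → k (K x e)

  -- A K-letter whose agent b comes with a witness of P b is fixed: its literal stays a hypothesis.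
  -- All other letters are free and get eliminated by case analysis.
  Selection : (P F : A → Set) → Formula A → Set
  Selection P F = Each (λ b → P b ⊎ F b)

  fixed : Selection P F ψ → Val ψ → List (Formula A)
  fixed atom                             _       = []
  fixed ⊥'                               _       = []
  fixed (s ⇒ t)                          (v , w) = fixed s v ++ fixed t w
  fixed (K {a = b} {ψ = ψ} (inj₁ _) s) (x , v) = lit (K b ψ) x ∷ fixed s v
  fixed (K (inj₂ _) s)                   (x , v) = fixed s v

  Agree : Selection P F ψ → Val ψ → Val ψ → Set
  Agree atom           _       _         = ⊤
  Agree ⊥'             _       _         = ⊤
  Agree (s ⇒ t)        (u , w) (u' , w') = Agree s u u' × Agree t w w'
  Agree (K (inj₁ _) s) (x , u) (y , v)   = x ≡ y × Agree s u v
  Agree (K (inj₂ _) s) (x , u) (y , v)   = Agree s u v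

  agree? : (s : Selection P F ψ) (u v : Val ψ) → Dec (Agree s u v)
  agree? atom           _       _         = yes tt
  agree? ⊥'             _       _         = yes tt
  agree? (s ⇒ t)        (u , w) (u' , w') = agree? s u u' ×-dec agree? t w w'
  agree? (K (inj₁ _) s) (x , u) (y , v)   = x Bool.≟ y ×-dec agree? s u v
  agree? (K (inj₂ _) s) (x , u) (y , v)   = agree? s u v

  Agree-restrict : (c : Sub φ ψ) (s : Selection P F φ) {u v : Val φ} →
                   Agree s u v → Agree (restrictEach c s) (restrict c u) (restrict c v)
  Agree-restrict root      s ag = ag
  Agree-restrict (left c)  s ag with restrictEach c s | Agree-restrict c s ag
  ... | _ ⇒ _ | ag₁ , _ = ag₁
  Agree-restrict (right c) s ag with restrictEach c s | Agree-restrict c s ag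
  ... | _ ⇒ _ | _ , ag₂ = ag₂
  Agree-restrict (under c) s ag with restrictEach c s | Agree-restrict c s ag
  ... | K (inj₁ _) _ | _ , ag₁ = ag₁
  ... | K (inj₂ _) _ | ag₁     = ag₁

  fixed⊆literals : (s : Selection P F ψ) (v : Val ψ) → fixed s v ⊆ literals ψ v
  fixed⊆literals atom           _       = λ ()
  fixed⊆literals ⊥'             _       = id
  fixed⊆literals (s ⇒ t)        (v , w) = ++⁺ (fixed⊆literals s v) (fixed⊆literals t w)
  fixed⊆literals (K (inj₁ _) s) (x , v) = ∷⁺ʳ _ (fixed⊆literals s v)
  fixed⊆literals (K (inj₂ _) s) (x , v) = there ∘ fixed⊆literals s v

  fixed-restrict : (c : Sub φ ψ) (s : Selection P F φ) (v : Val φ) →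
                   fixed (restrictEach c s) (restrict c v) ⊆ fixed s v
  fixed-restrict root      s v = id
  fixed-restrict (left c)  s v with restrictEach c s | fixed-restrict c s v
  ... | _ ⇒ _ | sub = sub ∘ xs⊆xs++ys _ _
  fixed-restrict (right c) s v with restrictEach c s | fixed-restrict c s v
  ... | _ ⇒ _ | sub = sub ∘ xs⊆ys++xs _ _
  fixed-restrict (under c) s v with restrictEach c s | fixed-restrict c s v
  ... | K (inj₁ _) _ | sub = sub ∘ there
  ... | K (inj₂ _) _ | sub = sub

  fixed-introspective : (s : Selection (_≡ a) F ψ) (v : Val ψ) → All (Introspective a) (fixed s v)
  fixed-introspective atom    _       = []
  fixed-introspective ⊥'      _       = []
  fixed-introspective (s ⇒ t) (v , w) = All.++⁺ (fixed-introspective s v) (fixed-introspective t w)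
  fixed-introspective (K {ψ = ψ} (inj₁ refl) s) (true , v)  = ax4 _ ψ ∷ fixed-introspective s v
  fixed-introspective (K {ψ = ψ} (inj₁ refl) s) (false , v) = ax5 _ ψ ∷ fixed-introspective s v
  fixed-introspective (K (inj₂ _) s)            (x , v)     = fixed-introspective s v

  mutual
    eliminate : (s : Selection P F ψ) (v : Val ψ) →
                (∀ u → Agree s u v → literals ψ u ++ Γ ⊢ᴴ θ) → fixed s v ++ Γ ⊢ᴴ θ
    eliminate atom _ k = by-cases (k true tt) (k false tt)
    eliminate ⊥'   _ k = k tt tt
    eliminate {ψ = ψ ⇒ χ} {Γ = Γ} (s ⇒ t) (v , w) k =
      reorder (↭-sym (++-assoc (fixed s v) (fixed t w) Γ)) $
      eliminate s v λ u su →
      reorder (shifts (fixed t w) (literals ψ u)) $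
      eliminate t w λ u' tu' →
      reorder (↭-trans (++-assoc (literals ψ u) (literals χ u') Γ)
                       (shifts (literals ψ u) (literals χ u')))
              (k (u , u') (su , tu'))
    eliminate (K (inj₁ _) s) (x , v) k = eliminate-behind s v λ u su → k (x , u) (refl , su)
    eliminate (K (inj₂ _) s) (x , v) k =
      by-cases (eliminate-behind s v λ u → k (true , u)) (eliminate-behind s v λ u → k (false , u))

    eliminate-behind : (s : Selection P F ψ) (v : Val ψ) →
                       (∀ u → Agree s u v → χ ∷ literals ψ u ++ Γ ⊢ᴴ θ) →
                       χ ∷ fixed s v ++ Γ ⊢ᴴ θ
    eliminate-behind {ψ = ψ} {Γ = Γ} s v k =
      reorder (shift _ (fixed s v) Γ) $
      eliminate s v λ u su → reorder (↭-sym (shift _ (literals ψ u) Γ)) (k u su)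

  eliminate-fixed : (s : Selection P F ψ) (v : Val ψ) →
                    (∀ u → Agree s u v → literals ψ u ⊢ᴴ θ) → fixed s v ⊢ᴴ θ
  eliminate-fixed s v k =
    subst (_⊢ᴴ _) (++-identityʳ (fixed s v))
          (eliminate s v λ u su → weaken (xs⊆xs++ys _ _) (k u su))

  noneFixed : (ψ : Formula A) → Selection (λ _ → ⊥) (λ _ → ⊤) ψ
  noneFixed (atom _) = atom
  noneFixed ⊥'       = ⊥'
  noneFixed (ψ ⇒ χ)  = noneFixed ψ ⇒ noneFixed χ
  noneFixed (K _ ψ)  = K (inj₂ tt) (noneFixed ψ)

  fixed-noneFixed : (ψ : Formula A) (v : Val ψ) → fixed (noneFixed ψ) v ≡ []
  fixed-noneFixed (atom _) _       = refl
  fixed-noneFixed ⊥'       _       = refl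
  fixed-noneFixed (ψ ⇒ χ)  (v , w) = cong₂ _++_ (fixed-noneFixed ψ v) (fixed-noneFixed χ w)
  fixed-noneFixed (K _ ψ)  (_ , v) = fixed-noneFixed ψ v

  eliminate-all : (∀ u → literals ψ u ⊢ᴴ θ) → [] ⊢ᴴ θ
  eliminate-all {ψ = ψ} k =
    subst (_⊢ᴴ _) (fixed-noneFixed ψ (allFalse ψ))
          (eliminate-fixed (noneFixed ψ) (allFalse ψ) λ u _ → k u)

funToFin-cong : {f g : Fin m → Fin n} → f ≗ g → funToFin f ≡ funToFin g
funToFin-cong {m = zero}  _   = refl
funToFin-cong {m = suc m} f≗g = cong₂ combine (f≗g Fin.zero) (funToFin-cong (f≗g ∘ Fin.suc))

funToFin-injective : {f g : Fin m → Fin n} → funToFin f ≡ funToFin g → f ≗ g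
funToFin-injective {f = f} {g} eq x =
  trans (sym (finToFun-funToFin f x)) (trans (cong (λ k → finToFun k x) eq) (finToFun-funToFin g x))

transpose-at : (i j : Fin n) → Perm.transpose i j ⟨$⟩ʳ i ≡ j
transpose-at i j with i ≟ᶠ i
... | yes _  = refl
... | no i≢i = ⊥-elim (i≢i refl)

mapRule : (ℕ → ℕ) → Rule → Rule
mapRule f (ps , q) = map f ps , f q

mapRule-cong : {f g : ℕ → ℕ} → f ≗ g → ∀ r → mapRule f r ≡ mapRule g r
mapRule-cong f≗g (ps , q) = cong₂ _,_ (map-cong f≗g ps) (f≗g q)

mapRule-∘ : {f g : ℕ → ℕ} → ∀ r → mapRule f (mapRule g r) ≡ mapRule (f ∘ g) r
mapRule-∘ (ps , q) = cong (_, _) (sym (map-∘ ps))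

mapRule-id : ∀ r → mapRule id r ≡ r
mapRule-id (ps , q) = cong (_, q) (map-id ps)

module WorldIndexedAtoms (M N : ℕ) where

  WorldMap : Set
  WorldMap = Fin N → Fin N

  isId? : (t : WorldMap) → Dec (t ≗ id)
  isId? t = all? λ x → t x ≟ᶠ x

  -- In the base of world i, atomAt p t stands for the atom p at world t i.  The identity map is
  -- coded by p itself, so that the atoms of φ (those below M) speak about the current world.
  atomAt : Fin M → WorldMap → ℕ
  atomAt p t with isId? t
  ... | yes _ = toℕ p
  ... | no  _ = M + toℕ (combine (funToFin t) p)

  bound : ℕ
  bound = M + N ^ N * M

  atomAt<bound : ∀ p t → atomAt p t < bound
  atomAt<bound p t with isId? t
  ... | yes _ = <-≤-trans (toℕ<n p) (m≤m+n M _)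
  ... | no  _ = +-monoʳ-< M (toℕ<n (combine (funToFin t) p))

  atomAt-id : ∀ p → atomAt p id ≡ toℕ p
  atomAt-id p with isId? id
  ... | yes _   = refl
  ... | no  ¬id = ⊥-elim (¬id λ _ → refl)

  atomAt-cong : ∀ p {t t'} → t ≗ t' → atomAt p t ≡ atomAt p t'
  atomAt-cong p {t} {t'} t≗t' with isId? t | isId? t'
  ... | yes _  | yes _   = refl
  ... | yes t≗ | no ¬t'≗ = ⊥-elim (¬t'≗ λ x → trans (sym (t≗t' x)) (t≗ x))
  ... | no ¬t≗ | yes t'≗ = ⊥-elim (¬t≗ λ x → trans (t≗t' x) (t'≗ x))
  ... | no _   | no _    = cong (λ k → M + toℕ (combine k p)) (funToFin-cong t≗t')

  atomAt-injective : ∀ {p p' t t'} → atomAt p t ≡ atomAt p' t' → p ≡ p' × t ≗ t'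
  atomAt-injective {p} {p'} {t} {t'} eq with isId? t | isId? t'
  ... | yes t≗ | yes t'≗ = toℕ-injective eq , λ x → trans (t≗ x) (sym (t'≗ x))
  ... | yes _  | no _    = ⊥-elim (<⇒≢ (<-≤-trans (toℕ<n p) (m≤m+n M _)) eq)
  ... | no _   | yes _   = ⊥-elim (<⇒≢ (<-≤-trans (toℕ<n p') (m≤m+n M _)) (sym eq))
  ... | no _   | no _    with combine-injective (funToFin t) p (funToFin t') p'
                                (toℕ-injective (+-cancelˡ-≡ M _ _ eq))
  ...   | t≡t' , p≡p' = p≡p' , funToFin-injective t≡t'

  IsAtomAt : ℕ → Set
  IsAtomAt n = ∃₂ λ (p : Fin M) (k : Fin (N ^ N)) → atomAt p (finToFun k) ≡ n

  isAtomAt? : ∀ n → Dec (IsAtomAt n)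
  isAtomAt? n = any? λ p → any? λ k → atomAt p (finToFun k) ≟ n

  atomAt-or-other : (Q : ℕ → Set) → (∀ p t → Q (atomAt p t)) → (∀ n → ¬ IsAtomAt n → Q n) →
                    ∀ n → Q n
  atomAt-or-other Q at other n with isAtomAt? n
  ... | yes (p , k , refl) = at p (finToFun k)
  ... | no  ¬at            = other n ¬at

  reindex : WorldMap → ℕ → ℕ
  reindex f n with isAtomAt? n
  ... | yes (p , k , _) = atomAt p (finToFun k ∘ f)
  ... | no  _           = n

  reindex-atomAt : ∀ f p t → reindex f (atomAt p t) ≡ atomAt p (t ∘ f)
  reindex-atomAt f p t with isAtomAt? (atomAt p t)
  ... | no ¬at = ⊥-elim (¬at (p , funToFin t , atomAt-cong p (finToFun-funToFin t)))
  ... | yes (_ , _ , eq) with atomAt-injective eq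
  ...   | refl , k≗t = atomAt-cong p (k≗t ∘ f)

  reindex-other : ∀ f → ¬ IsAtomAt n → reindex f n ≡ n
  reindex-other {n} f ¬at with isAtomAt? n
  ... | yes at = ⊥-elim (¬at at)
  ... | no  _  = refl

  reindex-cong : {f g : WorldMap} → f ≗ g → reindex f ≗ reindex g
  reindex-cong {f} {g} f≗g = atomAt-or-other (λ n → reindex f n ≡ reindex g n)
    (λ p t → trans (reindex-atomAt f p t)
                   (trans (atomAt-cong p (cong t ∘ f≗g)) (sym (reindex-atomAt g p t))))
    (λ n ¬at → trans (reindex-other f ¬at) (sym (reindex-other g ¬at)))

  reindex-∘ : ∀ f g n → reindex f (reindex g n) ≡ reindex (g ∘ f) n
  reindex-∘ f g = atomAt-or-other (λ n → reindex f (reindex g n) ≡ reindex (g ∘ f) n)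
    (λ p t → trans (cong (reindex f) (reindex-atomAt g p t))
                   (trans (reindex-atomAt f p (t ∘ g)) (sym (reindex-atomAt (g ∘ f) p t))))
    (λ n ¬at → trans (cong (reindex f) (reindex-other g ¬at))
                     (trans (reindex-other f ¬at) (sym (reindex-other (g ∘ f) ¬at))))

  reindex-id : reindex id ≗ id
  reindex-id = atomAt-or-other (λ n → reindex id n ≡ n) (reindex-atomAt id) (λ n → reindex-other id)

  reindex-inverse : {f g : WorldMap} → g ∘ f ≗ id → reindex f ∘ reindex g ≗ id
  reindex-inverse {f} {g} g∘f≗id n =
    trans (reindex-∘ f g n) (trans (reindex-cong g∘f≗id n) (reindex-id n))

  reindexBase : WorldMap → Base → Base
  reindexBase f B = B ∘ mapRule (reindex f)

  reindexBase-mono : ∀ f → B ⊆B C → reindexBase f B ⊆B reindexBase f C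
  reindexBase-mono f B⊆C r = B⊆C (mapRule (reindex f) r)

  reindexBase-≐ : ∀ f → B ≐B C → reindexBase f B ≐B reindexBase f C
  reindexBase-≐ f (B⊆C , C⊆B) = reindexBase-mono f B⊆C , reindexBase-mono f C⊆B

  reindexBase-cong : ∀ B {f g : WorldMap} → f ≗ g → reindexBase f B ≐B reindexBase g B
  reindexBase-cong B f≗g = ≐B-precompose {B = B} (mapRule-cong (reindex-cong f≗g))

  reindexBase-id : ∀ B → reindexBase id B ≐B B
  reindexBase-id B =
    ≐B-trans (≐B-precompose {B = B} (mapRule-cong reindex-id)) (≐B-precompose {B = B} mapRule-id)

  reindexBase-∘ : ∀ f g B → reindexBase f (reindexBase g B) ≐B reindexBase (f ∘ g) B
  reindexBase-∘ f g B =
    ≐B-precompose {B = B} λ r → trans (mapRule-∘ r) (mapRule-cong (reindex-∘ g f) r)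

  reindexBase-⊢ : ∀ f → reindexBase f B ⊢ n → B ⊢ reindex f n
  reindexBase-⊢ f = ⊢-map (reindex f) id

  ⊢-reindexBase : {f g : WorldMap} → g ∘ f ≗ id → B ⊢ n → reindexBase f B ⊢ reindex g n
  ⊢-reindexBase {B = B} {f = f} {g} g∘f≗id = ⊢-map (reindex g) λ {ps} {q} →
    subst B (sym (trans (mapRule-∘ (ps , q))
                 (trans (mapRule-cong (reindex-inverse g∘f≗id) (ps , q)) (mapRule-id (ps , q)))))

  inconsistent-reindexBase : (π : Permutation′ N) →
                             Inconsistent B → Inconsistent (reindexBase (π ⟨$⟩ʳ_) B)
  inconsistent-reindexBase {B = B} π inc n =
    subst (reindexBase (π ⟨$⟩ʳ_) B ⊢_) (reindex-inverse (λ _ → inverseʳ π) n)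
          (⊢-reindexBase (λ _ → inverseˡ π) (inc (reindex (π ⟨$⟩ʳ_) n)))

  reindexBase-inconsistent : (π : Permutation′ N) →
                             Inconsistent (reindexBase (π ⟨$⟩ʳ_) B) → Inconsistent B
  reindexBase-inconsistent {B = B} π inc n =
    subst (B ⊢_) (reindex-inverse (λ _ → inverseˡ π) n)
          (reindexBase-⊢ (π ⟨$⟩ʳ_) (inc (reindex (π ⟨$⟩ˡ_) n)))

  module _ {E : Fin N → Fin N → Set} (E-isEquivalence : IsEquivalence E) where

    open IsEquivalence E-isEquivalence renaming (refl to E-refl; sym to E-sym; trans to E-trans)

    Respects : Permutation′ N → Set
    Respects π = ∀ x → E x (π ⟨$⟩ʳ x)

    transpose-respects : ∀ {i j} → E i j → Respects (Perm.transpose i j)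
    transpose-respects {i} {j} Eij x with x ≟ᶠ i
    ... | yes refl = Eij
    ... | no _ with x ≟ᶠ j
    ...   | yes refl = E-sym Eij
    ...   | no _     = E-refl

    Reindexed : Rel
    Reindexed B C = Σ[ π ∈ Permutation′ N ] Respects π × C ≐B reindexBase (π ⟨$⟩ʳ_) B

    Reindexed-refl : ∀ B → Reindexed B B
    Reindexed-refl B = Perm.id , (λ _ → E-refl) , ≐B-sym (reindexBase-id B)

    Reindexed-trans : ∀ B C D → Reindexed B C → Reindexed C D → Reindexed B D
    Reindexed-trans B C D (π , π-resp , C≐) (σ , σ-resp , D≐) =
      π Perm.∘ₚ σ , (λ x → E-trans (π-resp x) (σ-resp _)) ,
      ≐B-trans D≐ (≐B-trans (reindexBase-≐ (σ ⟨$⟩ʳ_) C≐)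
                            (reindexBase-∘ (σ ⟨$⟩ʳ_) (π ⟨$⟩ʳ_) B))

    Reindexed-euclidean : ∀ B C D → Reindexed B C → Reindexed B D → Reindexed C D
    Reindexed-euclidean B C D (π , π-resp , C≐) (σ , σ-resp , D≐) = κ , κ-resp , D≐κC
      where
      κ : Permutation′ N
      κ = Perm.flip π Perm.∘ₚ σ
      κ-resp : Respects κ
      κ-resp x = E-trans (E-sym (subst (E _) (inverseʳ π) (π-resp (π ⟨$⟩ˡ x)))) (σ-resp _)
      κC≐D : reindexBase (κ ⟨$⟩ʳ_) C ≐B D
      κC≐D = ≐B-trans (reindexBase-≐ (κ ⟨$⟩ʳ_) C≐) $
             ≐B-trans (reindexBase-∘ (κ ⟨$⟩ʳ_) (π ⟨$⟩ʳ_) B) $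
             ≐B-trans (reindexBase-cong B λ x → cong (σ ⟨$⟩ʳ_) (inverseˡ π)) (≐B-sym D≐)
      D≐κC : D ≐B reindexBase (κ ⟨$⟩ʳ_) C
      D≐κC = ≐B-sym κC≐D

    Reindexed-isS5 : IsS5Modal Reindexed
    Reindexed-isS5 = record
      { refl      = Reindexed-refl
      ; trans     = Reindexed-trans
      ; euclidean = Reindexed-euclidean
      ; condA     = λ B inc → (B , Reindexed-refl B , inc) ,
                      λ D (π , _ , D≐) → inconsistent-mono (proj₂ D≐) (inconsistent-reindexBase π inc)
      ; condB     = λ B B-consistent C (π , _ , C≐) C-inc →
                      B-consistent (reindexBase-inconsistent π (inconsistent-mono (proj₁ C≐) C-inc))
      ; condC     = λ B C (π , π-resp , C≐) D _ B⊆D →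
                      reindexBase (π ⟨$⟩ʳ_) D , ⊆B-trans (proj₁ C≐) (reindexBase-mono _ B⊆D) ,
                      π , π-resp , ≐B-refl
      ; condD     = λ B C _ (π , π-resp , C≐) D D⊆B →
                      reindexBase (π ⟨$⟩ʳ_) D , ⊆B-trans (reindexBase-mono _ D⊆B) (proj₂ C≐) ,
                      π , π-resp , ≐B-refl
      }

Valid : {A : Set} → Formula A → Set₁
Valid {A} φ = (R : A → Rel) → (∀ a → IsS5Modal (R a)) → (B : Base) → ⊩ R B φ

record Worlds {A : Set} (T : Set) (φ : Formula A) : Set where
  field
    size             : ℕ
    world            : Fin size → Val φ
    world-consistent : ∀ j → Contradictory φ (world j) → T
    covers           : ∀ u → Contradictory φ u ⊎ ∃ λ j → world j ≡ u

module _ {A : Set} {φ : Formula A} where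

  consistentOnly : (us : List (Val φ)) → All (Decᵀ T ∘ Contradictory φ) us →
                   List (Σ (Val φ) λ u → Contradictory φ u → T)
  consistentOnly []       []            = []
  consistentOnly (_ ∷ us) (inj₁ _ ∷ ds) = consistentOnly us ds
  consistentOnly (u ∷ us) (inj₂ c ∷ ds) = (u , c) ∷ consistentOnly us ds

  consistentOnly-covers : ∀ {u us} → u ∈ us → (ds : All (Decᵀ T ∘ Contradictory φ) us) →
                          Contradictory φ u ⊎ Any (λ w → proj₁ w ≡ u) (consistentOnly us ds)
  consistentOnly-covers (here refl) (inj₁ c ∷ _)  = inj₁ c
  consistentOnly-covers (here refl) (inj₂ _ ∷ _)  = inj₂ (here refl)
  consistentOnly-covers (there u∈)  (inj₁ _ ∷ ds) = consistentOnly-covers u∈ ds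
  consistentOnly-covers (there u∈)  (inj₂ _ ∷ ds) = Sum.map₂ there (consistentOnly-covers u∈ ds)

worldsᶜ : {A : Set} (φ : Formula A) → Cont T (Worlds T φ)
worldsᶜ {T = T} φ k = allᶜ (λ _ → decideᵀ) (valuations φ) λ ds → k (worlds ds)
  where
  worlds : All (Decᵀ T ∘ Contradictory φ) (valuations φ) → Worlds T φ
  worlds ds = record
    { size             = length ws
    ; world            = proj₁ ∘ lookup ws
    ; world-consistent = proj₂ ∘ lookup ws
    ; covers           = λ u → Sum.map₂ (λ w∈ → index w∈ , lookup-index w∈)
                                         (consistentOnly-covers (∈-valuations φ u) ds)
    }
    where
    ws : List (Σ (Val φ) λ u → Contradictory φ u → T)
    ws = consistentOnly (valuations φ) ds

-- Equality of agents is not decidable, so for every agent a of a K-occurrence of φ and every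
-- K-occurrence K b _ of φ, it is only decided relative to T whether b ≡ a.
AgentDecisions : {A : Set} → Set → Formula A → Set
AgentDecisions T φ = Each (λ a → Selection (_≡ a) (λ b → b ≡ a → T) φ) φ

agentDecisionsᶜ : {A : Set} (φ : Formula A) → Cont T (AgentDecisions T φ)
agentDecisionsᶜ φ = eachᶜ (λ _ → eachᶜ (λ _ → decideᵀ) φ) φ

module CanonicalModel {A T : Set} {φ : Formula A} (W : Worlds T φ) (decisions : AgentDecisions T φ) where

  open Worlds W
  open WorldIndexedAtoms (suc (maxAtom φ)) size

  letterAt : {a : A} {ψ : Formula A} → Sub φ (K a ψ) → Fin size → Bool
  letterAt c j = proj₁ (restrict c (world j))

  Accessible : A → Fin size → Fin size → Set
  Accessible a i j = ∀ {b χ} (c : Sub φ (K b χ)) → b ≡ a → letterAt c i ≡ letterAt c j ⊎ T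

  Accessible-isEquivalence : ∀ a → IsEquivalence (Accessible a)
  Accessible-isEquivalence a = record
    { refl  = λ _ _ → inj₁ refl
    ; sym   = λ i∼j c b≡a → Sum.map₁ sym (i∼j c b≡a)
    ; trans = λ i∼j j∼k c b≡a → trans-or (i∼j c b≡a) (j∼k c b≡a)
    }
    where
    trans-or : {x y z : Bool} → x ≡ y ⊎ T → y ≡ z ⊎ T → x ≡ z ⊎ T
    trans-or (inj₁ x≡y) (inj₁ y≡z) = inj₁ (trans x≡y y≡z)
    trans-or (inj₂ t)   _          = inj₂ t
    trans-or _          (inj₂ t)   = inj₂ t

  R : A → Rel
  R a = Reindexed (Accessible-isEquivalence a)

  R-isS5 : ∀ a → IsS5Modal (R a)
  R-isS5 a = Reindexed-isS5 (Accessible-isEquivalence a)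

  decisionsFor : ∀ {a ψ} → Sub φ (K a ψ) → Selection (_≡ a) (λ b → b ≡ a → T) φ
  decisionsFor c = Each-head (restrictEach c decisions)

  agree⇒accessible : ∀ {a} (s : Selection (_≡ a) (λ b → b ≡ a → T) φ) {i j} →
                     Agree s (world i) (world j) → Accessible a i j
  agree⇒accessible s agrees c b≡a with restrictEach c s | Agree-restrict c s agrees
  ... | K (inj₁ _) _   | same , _ = inj₁ same
  ... | K (inj₂ b≢a) _ | _        = inj₂ (b≢a b≡a)

  -- explode turns the T-relative contradictions of the worlds into inconsistent bases.
  data Canonical (i : Fin size) : Base where
    fact    : ∀ p t → atom (toℕ p) ∈ literals φ (world (t i)) → Canonical i ([] , atomAt p t)
    refute  : ∀ p t q → ¬' (atom (toℕ p)) ∈ literals φ (world (t i)) → Canonical i ([ atomAt p t ] , q)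
    explode : ∀ q → T → Canonical i ([] , q)

  explode-⊆ : ∀ {i C} → Canonical i ⊆B C → T → Inconsistent C
  explode-⊆ X⊆C t q = use (X⊆C _ (explode q t)) []

  canonical-reindex : ∀ f i → Canonical (f i) ⊆B reindexBase f (Canonical i)
  canonical-reindex f i _ (fact p t l∈) =
    subst (λ n → Canonical i ([] , n)) (sym (reindex-atomAt f p t)) (fact p (t ∘ f) l∈)
  canonical-reindex f i _ (refute p t q l∈) =
    subst (λ n → Canonical i ([ n ] , reindex f q)) (sym (reindex-atomAt f p t))
          (refute p (t ∘ f) (reindex f q) l∈)
  canonical-reindex f i _ (explode q t) = explode (reindex f q) t

  successor : ∀ {a i C D} → Canonical i ⊆B C → (CD : R a C D) → Canonical (proj₁ CD ⟨$⟩ʳ i) ⊆B D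
  successor {i = i} X⊆C (π , _ , D≐) =
    ⊆B-trans (canonical-reindex (π ⟨$⟩ʳ_) i) (⊆B-trans (reindexBase-mono _ X⊆C) (proj₂ D≐))

  derivable : ∀ {i n} → Canonical i ⊢ n →
              T ⊎ ∃₂ λ p t → atomAt p t ≡ n × atom (toℕ p) ∈ literals φ (world (t i))
  derivable (use (fact p t l∈) []) = inj₂ (p , t , refl , l∈)
  derivable (use (explode q x) []) = inj₁ x
  derivable {i} (use (refute p t q ¬l∈) (d ∷ [])) with derivable d
  ... | inj₁ x = inj₁ x
  ... | inj₂ (_ , t' , eq , l∈) with atomAt-injective eq
  ...   | refl , t'≗t = inj₁ (world-consistent (t i) (⇒-elim (hyp ¬l∈) (hyp l∈')))
    where
    l∈' : atom (toℕ p) ∈ literals φ (world (t i))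
    l∈' = subst (λ j → atom (toℕ p) ∈ literals φ (world j)) (t'≗t i) l∈

  canonical-consistent : ∀ {i} → Inconsistent (Canonical i) → T
  canonical-consistent inc with derivable (inc bound)
  ... | inj₁ x                = x
  ... | inj₂ (p , t , eq , _) = ⊥-elim (<⇒≢ (atomAt<bound p t) eq)

  atomIndex : ∀ {q} → Sub φ (atom q) → Fin (suc (maxAtom φ))
  atomIndex c = fromℕ< (s≤s (maxAtom-sub c))

  atomAt-atomIndex : ∀ {q} (c : Sub φ (atom q)) → atomAt (atomIndex c) id ≡ q
  atomAt-atomIndex c = trans (atomAt-id _) (toℕ-fromℕ< _)

  atom-literal : ∀ {q i} (c : Sub φ (atom q)) →
                 lit (atom (toℕ (atomIndex c))) (restrict c (world i)) ∈ literals φ (world i)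
  atom-literal {i = i} c = subst (λ n → lit (atom n) (restrict c (world i)) ∈ literals φ (world i))
                                 (sym (toℕ-fromℕ< _)) (literals-restrict c (world i) (here refl))

  factive : ∀ {a ψ} (c : Sub φ (K a ψ)) j → letterAt c j ≡ true →
            eval ψ (restrict (under c) (world j)) ≡ true ⊎ T
  factive {a} {ψ} c j Kψ-true with eval ψ (restrict (under c) (world j)) in ψ-value
  ... | true  = inj₁ refl
  ... | false = inj₂ (world-consistent j (⇒-elim ¬ψ (⇒-elim (thm (axT a ψ)) (hyp Kψ∈))))
    where
    ¬ψ : literals φ (world j) ⊢ᴴ ¬' ψ
    ¬ψ = weaken (literals-restrict (under c) (world j)) (kalmar-false ψ _ ψ-value)
    Kψ∈ : K a ψ ∈ literals φ (world j)
    Kψ∈ = subst (λ x → lit (K a ψ) x ∈ literals φ (world j)) Kψ-true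
                (literals-restrict c (world j) (here refl))

  no-counterexample⇒T : ∀ {a ψ i} (c : Sub φ (K a ψ)) → letterAt c i ≡ false →
    (∀ j → Agree (decisionsFor c) (world j) (world i) →
           eval ψ (restrict (under c) (world j)) ≡ true) →
    T
  no-counterexample⇒T {a} {ψ} {i} c Kψ-false ψ-true
    with restrictEach c (decisionsFor c) | fixed-restrict c (decisionsFor c) (world i)
  ... | K (inj₂ a≢a) _ | _      = a≢a refl
  ... | K (inj₁ _) _   | fixed⊆ =
    world-consistent i (weaken (fixed⊆literals s (world i)) (⇒-elim (hyp ¬Kψ∈) □ψ))
    where
    s : Selection (_≡ a) (λ b → b ≡ a → T) φ
    s = decisionsFor c
    ¬Kψ∈ : ¬' (K a ψ) ∈ fixed s (world i)
    ¬Kψ∈ = subst (λ x → lit (K a ψ) x ∈ fixed s (world i)) Kψ-false (fixed⊆ (here refl))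
    ψ-from-literals : ∀ u → Agree s u (world i) → literals φ u ⊢ᴴ ψ
    ψ-from-literals u agrees with covers u
    ... | inj₁ contradictory = ⊥-elimᴴ contradictory
    ... | inj₂ (j , refl)    =
      weaken (literals-restrict (under c) (world j)) (kalmar-true ψ _ (ψ-true j agrees))
    □ψ : fixed s (world i) ⊢ᴴ K a ψ
    □ψ = K-intro (fixed-introspective s (world i)) (eliminate-fixed s (world i) ψ-from-literals)

  mutual
    true⇒⊩ : ∀ ψ (c : Sub φ ψ) {i C} → Canonical i ⊆B C →
             eval ψ (restrict c (world i)) ≡ true → ⊩ R C ψ
    true⇒⊩ (atom q) c {i} {C} X⊆C q-true =
      lift (subst (C ⊢_) (atomAt-atomIndex c) (use (X⊆C _ (fact (atomIndex c) id q∈)) []))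
      where
      q∈ : atom (toℕ (atomIndex c)) ∈ literals φ (world i)
      q∈ = subst (λ x → lit (atom _) x ∈ literals φ (world i)) q-true (atom-literal c)
    true⇒⊩ (ψ ⇒ χ) c {i} X⊆C ψ⇒χ-true D C⊆D ⊩ψ
      with ⇒ᵇ-true (eval ψ (restrict (left c) (world i))) ψ⇒χ-true
    ... | inj₁ ψ-false =
      inconsistent⇒⊩ R-isS5 (⊩-false⇒inconsistent ψ (left c) (⊆B-trans X⊆C C⊆D) ⊩ψ ψ-false)
    ... | inj₂ χ-true  = true⇒⊩ χ (right c) (⊆B-trans X⊆C C⊆D) χ-true
    true⇒⊩ (K a ψ) c X⊆C Kψ-true = K-true⇒⊩ c X⊆C Kψ-true

    ⊩-false⇒inconsistent : ∀ ψ (c : Sub φ ψ) {i C} → Canonical i ⊆B C → ⊩ R C ψ →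
                           eval ψ (restrict c (world i)) ≡ false → Inconsistent C
    ⊩-false⇒inconsistent (atom q) c {i} {C} X⊆C (lift ⊢q) q-false r =
      use (X⊆C _ (refute (atomIndex c) id r ¬q∈)) (subst (C ⊢_) (sym (atomAt-atomIndex c)) ⊢q ∷ [])
      where
      ¬q∈ : ¬' (atom (toℕ (atomIndex c))) ∈ literals φ (world i)
      ¬q∈ = subst (λ x → lit (atom _) x ∈ literals φ (world i)) q-false (atom-literal c)
    ⊩-false⇒inconsistent ⊥' c X⊆C (lift inc) _ = inc
    ⊩-false⇒inconsistent (ψ ⇒ χ) c {i} X⊆C ⊩ψ⇒χ ψ⇒χ-false
      with ⇒ᵇ-false (eval ψ (restrict (left c) (world i))) ψ⇒χ-false
    ... | ψ-true , χ-false =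
      ⊩-false⇒inconsistent χ (right c) X⊆C (⊩ψ⇒χ _ (λ _ → id) (true⇒⊩ ψ (left c) X⊆C ψ-true)) χ-false
    ⊩-false⇒inconsistent (K a ψ) c X⊆C ⊩Kψ Kψ-false = ⊩K-false⇒inconsistent c X⊆C ⊩Kψ Kψ-false

    K-true⇒⊩ : ∀ {a ψ i C} (c : Sub φ (K a ψ)) → Canonical i ⊆B C →
               letterAt c i ≡ true → ⊩ R C (K a ψ)
    K-true⇒⊩ {ψ = ψ} {i} c X⊆C Kψ-true D CD@(π , π-resp , _) =
      Sum.[ true⇒⊩ ψ (under c) X⊆D , inconsistent⇒⊩ R-isS5 ∘ explode-⊆ X⊆D ] ψ-true-at-successor
      where
      X⊆D : Canonical (π ⟨$⟩ʳ i) ⊆B D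
      X⊆D = successor X⊆C CD
      ψ-true-at-successor : eval ψ (restrict (under c) (world (π ⟨$⟩ʳ i))) ≡ true ⊎ T
      ψ-true-at-successor with π-resp i c refl
      ... | inj₁ same = factive c _ (trans (sym same) Kψ-true)
      ... | inj₂ x    = inj₂ x

    -- Either an a-accessible world j falsifies ψ, and transposing i and j is an a-successor of C
    -- extending Canonical j, or ψ holds wherever the K_a-letters agree with world i.
    ⊩K-false⇒inconsistent : ∀ {a ψ i C} (c : Sub φ (K a ψ)) → Canonical i ⊆B C →
                            ⊩ R C (K a ψ) → letterAt c i ≡ false → Inconsistent C
    ⊩K-false⇒inconsistent {ψ = ψ} {i} c X⊆C ⊩Kψ Kψ-false
      with any? (λ j → agree? (decisionsFor c) (world j) (world i)
                       ×-dec eval ψ (restrict (under c) (world j)) Bool.≟ false)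
    ... | yes (j , agrees , ψ-false) =
      counterexample⇒inconsistent c X⊆C ⊩Kψ (agree⇒accessible (decisionsFor c) agrees) ψ-false
    ... | no ∄counterexample = explode-⊆ X⊆C (no-counterexample⇒T c Kψ-false λ j agrees →
            Bool.¬-not λ ψ-false → ∄counterexample (j , agrees , ψ-false))

    counterexample⇒inconsistent : ∀ {a ψ i j C} (c : Sub φ (K a ψ)) → Canonical i ⊆B C →
                                  ⊩ R C (K a ψ) → Accessible a j i →
                                  eval ψ (restrict (under c) (world j)) ≡ false → Inconsistent C
    counterexample⇒inconsistent {a} {ψ} {i} {j} {C} c X⊆C ⊩Kψ j∼i ψ-false =
      reindexBase-inconsistent π (⊩-false⇒inconsistent ψ (under c) X⊆D (⊩Kψ _ CD) ψ-false)
      where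
      open IsEquivalence (Accessible-isEquivalence a) using () renaming (sym to ∼-sym)
      π : Permutation′ size
      π = Perm.transpose i j
      CD : R a C (reindexBase (π ⟨$⟩ʳ_) C)
      CD = π , transpose-respects (Accessible-isEquivalence a) (∼-sym j∼i) , ≐B-refl
      X⊆D : Canonical j ⊆B reindexBase (π ⟨$⟩ʳ_) C
      X⊆D = subst (λ k → Canonical k ⊆B reindexBase (π ⟨$⟩ʳ_) C) (transpose-at i j)
                  (successor X⊆C CD)

  valid⇒true : Valid φ → ∀ j → eval φ (world j) ≡ true ⊎ T
  valid⇒true valid j with eval φ (world j) in φ-value
  ... | true  = inj₁ refl
  ... | false = inj₂ (canonical-consistent
                        (⊩-false⇒inconsistent φ root (λ _ → id) (valid R R-isS5 (Canonical j)) φ-value))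

completeness : {A : Set} {φ : Formula A} →
               Worlds (Thm φ) φ → AgentDecisions (Thm φ) φ → Valid φ → Thm φ
completeness {φ = φ} W decisions valid = []⊢ᴴ⇒Thm (eliminate-all case)
  where
  open Worlds W
  case : ∀ u → literals φ u ⊢ᴴ φ
  case u with covers u
  ... | inj₁ contradictory = ⊥-elimᴴ contradictory
  ... | inj₂ (j , refl)    =
    Sum.[ kalmar-true φ (world j) , thm ] (CanonicalModel.valid⇒true W decisions valid j)

theorem5p4 : {A : Set} → A → (φ : Formula A) →
    ((R : A → Rel) → (∀ a → IsS5Modal (R a)) → (B : Base) → ⊩ R B φ) →
    Thm φ
theorem5p4 _ φ valid =
  worldsᶜ φ λ W → agentDecisionsᶜ φ λ decisions → completeness W decisions valid
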